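{- For each integer $k\ge 3$ and each nonnegative integer $t$: (a) $m_2^{(1)}(k-1,3t+2)=t v_k+2^{k-1}$; (b) $m_2^{(1)}(k-1,3t+3)=(t+1)v_k$; (c) $m_2^{(1)}(k-1,3t+4)=(t+1)v_k+1$, where $v_k=2^k-1$.
   Context: For a prime power $q$, integers $0\le r< N$ and $w\ge 0$, $m_q^{(r)}(N,w)$ denotes the maximum total multiplicity of a multiset of points in the projective space $\mathrm{PG}(N,q)$ (a map $\mathcal{M}$ from points to nonnegative integers) such that every $r$-dimensional projective subspace $S$ has multiplicity $\sum_{P\in S}\mathcal{M}(P)\le w$. -}

module Defs where

open import Data.Nat using (ℕ; zero; suc; _+_; _∸_; _^_; _≤_)
open import Data.Bool using (Bool; true; false; _xor_; _∨_; not)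
open import Data.Vec using (Vec; []; _∷_; zipWith)
open import Data.List using (List; []; _∷_; map; _++_; filterᵇ)
open import Data.Nat.ListAction using (sum)
open import Data.Product using (Σ; _×_; _,_)
open import Relation.Binary.PropositionalEquality using (_≡_; _≢_)

-- Coordinate vectors of F_2^n (Bool = GF(2), xor = addition).
Vec2 : ℕ → Set
Vec2 n = Vec Bool n

allVecs : (n : ℕ) → List (Vec2 n)
allVecs zero = [] ∷ []
allVecs (suc n) = map (false ∷_) (allVecs n) ++ map (true ∷_) (allVecs n)

nonzeroᵇ : ∀ {n} → Vec2 n → Bool
nonzeroᵇ [] = false
nonzeroᵇ (x ∷ v) = x ∨ nonzeroᵇ v

zeroVec : (n : ℕ) → Vec2 n
zeroVec zero = []
zeroVec (suc n) = false ∷ zeroVec n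

_⊕_ : ∀ {n} → Vec2 n → Vec2 n → Vec2 n
_⊕_ = zipWith _xor_

-- Points of PG(N,2) are the nonzero vectors of F_2^(N+1) (over GF(2) each
-- 1-dimensional subspace has a unique nonzero vector).
-- A multiset of points: a map to ℕ; its value on the zero vector is irrelevant
-- (the zero vector is not a point and is never counted).
Multiset : ℕ → Set
Multiset N = Vec2 (suc N) → ℕ

total : ∀ {N} → Multiset N → ℕ
total {N} M = sum (map M (filterᵇ nonzeroᵇ (allVecs (suc N))))

-- Lines of PG(N,2): for distinct points a ≠ b, the line through them is
-- {a, b, a ⊕ b}.  Every line arises this way.  Multiplicity of that line:
lineMult : ∀ {N} → Multiset N → Vec2 (suc N) → Vec2 (suc N) → ℕ
lineMult M a b = M a + M b + M (a ⊕ b)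

LineBounded : ∀ {N} → ℕ → Multiset N → Set
LineBounded {N} w M =
  (a b : Vec2 (suc N)) → a ≢ zeroVec (suc N) → b ≢ zeroVec (suc N) → a ≢ b →
  lineMult M a b ≤ w

IsM2Line : ℕ → ℕ → ℕ → Set
IsM2Line N w m =
  (Σ (Multiset N) λ M → LineBounded w M × total M ≡ m) ×
  ((M : Multiset N) → LineBounded w M → total M ≤ m)

v : ℕ → ℕ
v k = 2 ^ k ∸ 1

module Submission where

-- Upper bound: fix a threshold c.  If every point has multiplicity at most c, the total is at
-- most c·v_k.  Otherwise some point a has multiplicity m > c; the 2^(k-1) - 1 lines through a
-- partition the remaining points, and on each of them these have multiplicity at most w - m, so
-- the total is at most m + (2^(k-1) - 1)(w - m), which decreases in m.  With c = t for w = 3t+2, 3t+3 and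
-- c = t+1 for w = 3t+4 both bounds are at most the claimed values.  These are attained by
-- t + x₀ (x₀ the first coordinate: no line has three points with x₀ = 1), by the constant t+1,
-- and by the constant t+1 plus one extra point.

open import Defs
open import Data.Bool using (Bool; true; false; if_then_else_)
import Data.Bool.Properties as Bool
open import Data.Empty using (⊥-elim)
open import Data.List using ([]; _∷_; _++_; map; filterᵇ)
open import Data.List.Properties using (map-++; map-∘; map-cong)
open import Data.Nat using (ℕ; zero; suc; _+_; _*_; _∸_; _^_; _≤_; _<?_; z≤n; s≤s; >-nonZero)
open import Data.Nat.ListAction using (sum)
open import Data.Nat.ListAction.Properties using (sum-++)
open import Data.Nat.Properties hiding (_≟_)
open import Data.Nat.Tactic.RingSolver using (solve-∀)
open import Data.Product using (∃; _×_; _,_)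
open import Data.Sum using (_⊎_; inj₁; inj₂)
open import Data.Vec using ([]; _∷_)
open import Data.Vec.Properties using (≡-dec; zipWith-assoc; zipWith-comm)
open import Function using (_∘_)
open import Relation.Binary.Definitions using (DecidableEquality)
open import Relation.Binary.PropositionalEquality
open import Relation.Nullary using (Dec; yes; no; does; ¬?; _×-dec_; _⊎-dec_)
open import Relation.Nullary.Decidable using (map′; dec-false)
open import Relation.Unary using (Decidable)

_≟_ : ∀ {n} → DecidableEquality (Vec2 n)
_≟_ = ≡-dec Bool._≟_

⊕-assoc : ∀ {n} (a b c : Vec2 n) → (a ⊕ b) ⊕ c ≡ a ⊕ (b ⊕ c)
⊕-assoc = zipWith-assoc Bool.xor-assoc

⊕-comm : ∀ {n} (a b : Vec2 n) → a ⊕ b ≡ b ⊕ a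
⊕-comm = zipWith-comm Bool.xor-comm

⊕-identityˡ : ∀ {n} (a : Vec2 n) → zeroVec n ⊕ a ≡ a
⊕-identityˡ [] = refl
⊕-identityˡ (x ∷ a) = cong (x ∷_) (⊕-identityˡ a)

⊕-identityʳ : ∀ {n} (a : Vec2 n) → a ⊕ zeroVec n ≡ a
⊕-identityʳ a = trans (⊕-comm a _) (⊕-identityˡ a)

⊕-self : ∀ {n} (a : Vec2 n) → a ⊕ a ≡ zeroVec n
⊕-self [] = refl
⊕-self (x ∷ a) = cong₂ _∷_ (Bool.xor-same x) (⊕-self a)

⊕-involutiveˡ : ∀ {n} (a b : Vec2 n) → a ⊕ (a ⊕ b) ≡ b
⊕-involutiveˡ a b = begin
  a ⊕ (a ⊕ b)    ≡⟨ ⊕-assoc a a b ⟨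
  (a ⊕ a) ⊕ b    ≡⟨ cong (_⊕ b) (⊕-self a) ⟩
  zeroVec _ ⊕ b  ≡⟨ ⊕-identityˡ b ⟩
  b              ∎
  where open ≡-Reasoning

⊕-cancelˡ : ∀ {n} (a : Vec2 n) {b c} → a ⊕ b ≡ a ⊕ c → b ≡ c
⊕-cancelˡ a {b} {c} eq = begin
  b            ≡⟨ ⊕-involutiveˡ a b ⟨
  a ⊕ (a ⊕ b)  ≡⟨ cong (a ⊕_) eq ⟩
  a ⊕ (a ⊕ c)  ≡⟨ ⊕-involutiveˡ a c ⟩
  c            ∎
  where open ≡-Reasoning

⊕≡zero⇒≡ : ∀ {n} (a b : Vec2 n) → a ⊕ b ≡ zeroVec n → a ≡ b
⊕≡zero⇒≡ a b eq = sym (⊕-cancelˡ a (trans eq (sym (⊕-self a))))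

⊕≡ˡ⇒≡zero : ∀ {n} (a b : Vec2 n) → a ⊕ b ≡ a → b ≡ zeroVec n
⊕≡ˡ⇒≡zero a b eq = ⊕-cancelˡ a (trans eq (sym (⊕-identityʳ a)))

nonzeroᵇ-zeroVec : ∀ n → nonzeroᵇ (zeroVec n) ≡ false
nonzeroᵇ-zeroVec zero = refl
nonzeroᵇ-zeroVec (suc n) = nonzeroᵇ-zeroVec n

nonzeroᵇ≡false⇒≡zeroVec : ∀ {n} (b : Vec2 n) → nonzeroᵇ b ≡ false → b ≡ zeroVec n
nonzeroᵇ≡false⇒≡zeroVec [] _ = refl
nonzeroᵇ≡false⇒≡zeroVec (false ∷ b) eq = cong (false ∷_) (nonzeroᵇ≡false⇒≡zeroVec b eq)

any? : ∀ {n} {P : Vec2 n → Set} → Decidable P → Dec (∃ P)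
any? {zero} P? = map′ ([] ,_) (λ { ([] , p) → p }) (P? [])
any? {suc n} {P} P? =
  map′ join split (any? (P? ∘ (false ∷_)) ⊎-dec any? (P? ∘ (true ∷_)))
  where
  join : ∃ (P ∘ (false ∷_)) ⊎ ∃ (P ∘ (true ∷_)) → ∃ P
  join (inj₁ (b , p)) = false ∷ b , p
  join (inj₂ (b , p)) = true ∷ b , p
  split : ∃ P → ∃ (P ∘ (false ∷_)) ⊎ ∃ (P ∘ (true ∷_))
  split (false ∷ b , p) = inj₁ (b , p)
  split (true ∷ b , p) = inj₂ (b , p)

module _ {A : Set} where

  sum-map-+ : ∀ (f g : A → ℕ) xs →
              sum (map (λ x → f x + g x) xs) ≡ sum (map f xs) + sum (map g xs)
  sum-map-+ f g [] = refl
  sum-map-+ f g (x ∷ xs) = begin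
    f x + g x + sum (map (λ x → f x + g x) xs)
      ≡⟨ cong (f x + g x +_) (sum-map-+ f g xs) ⟩
    f x + g x + (sum (map f xs) + sum (map g xs))
      ≡⟨ +-+-swap (f x) (g x) _ _ ⟩
    f x + sum (map f xs) + (g x + sum (map g xs))  ∎
    where
    open ≡-Reasoning
    +-+-swap : ∀ a b c d → a + b + (c + d) ≡ a + c + (b + d)
    +-+-swap = solve-∀

  sum-map-mono : ∀ {f g : A → ℕ} → (∀ x → f x ≤ g x) → ∀ xs → sum (map f xs) ≤ sum (map g xs)
  sum-map-mono f≤g [] = z≤n
  sum-map-mono f≤g (x ∷ xs) = +-mono-≤ (f≤g x) (sum-map-mono f≤g xs)

  sum-map-filterᵇ : ∀ (p : A → Bool) (f : A → ℕ) xs →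
                    sum (map f (filterᵇ p xs)) ≡ sum (map (λ x → if p x then f x else 0) xs)
  sum-map-filterᵇ p f [] = refl
  sum-map-filterᵇ p f (x ∷ xs) with p x
  ... | true  = cong (f x +_) (sum-map-filterᵇ p f xs)
  ... | false = sum-map-filterᵇ p f xs

sumAll : (n : ℕ) → (Vec2 n → ℕ) → ℕ
sumAll n f = sum (map f (allVecs n))

sumAll-suc : ∀ n (f : Vec2 (suc n) → ℕ) →
             sumAll (suc n) f ≡ sumAll n (f ∘ (false ∷_)) + sumAll n (f ∘ (true ∷_))
sumAll-suc n f = begin
  sum (map f (map (false ∷_) vs ++ map (true ∷_) vs))
    ≡⟨ cong sum (map-++ f (map (false ∷_) vs) _) ⟩
  sum (map f (map (false ∷_) vs) ++ map f (map (true ∷_) vs))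
    ≡⟨ sum-++ (map f (map (false ∷_) vs)) _ ⟩
  sum (map f (map (false ∷_) vs)) + sum (map f (map (true ∷_) vs))
    ≡⟨ cong₂ (λ xs ys → sum xs + sum ys) (map-∘ vs) (map-∘ vs) ⟨
  sumAll n (f ∘ (false ∷_)) + sumAll n (f ∘ (true ∷_))  ∎
  where
  open ≡-Reasoning
  vs = allVecs n

sumAll-+ : ∀ n (f g : Vec2 n → ℕ) → sumAll n (λ b → f b + g b) ≡ sumAll n f + sumAll n g
sumAll-+ n f g = sum-map-+ f g (allVecs n)

sumAll-mono : ∀ n {f g : Vec2 n → ℕ} → (∀ b → f b ≤ g b) → sumAll n f ≤ sumAll n g
sumAll-mono n f≤g = sum-map-mono f≤g (allVecs n)

sumAll-cong : ∀ n {f g : Vec2 n → ℕ} → (∀ b → f b ≡ g b) → sumAll n f ≡ sumAll n g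
sumAll-cong n f≗g = cong sum (map-cong f≗g (allVecs n))

sumAll-const : ∀ n c → sumAll n (λ _ → c) ≡ 2 ^ n * c
sumAll-const zero c = refl
sumAll-const (suc n) c = begin
  sumAll (suc n) (λ _ → c)                 ≡⟨ sumAll-suc n _ ⟩
  sumAll n (λ _ → c) + sumAll n (λ _ → c)  ≡⟨ cong₂ _+_ (sumAll-const n c) (sumAll-const n c) ⟩
  2 ^ n * c + 2 ^ n * c                    ≡⟨ cong (2 ^ n * c +_) (+-identityʳ _) ⟨
  2 * (2 ^ n * c)                          ≡⟨ *-assoc 2 (2 ^ n) c ⟨
  2 * 2 ^ n * c                            ∎
  where open ≡-Reasoning

sumAll-⊕ : ∀ n (a : Vec2 n) (f : Vec2 n → ℕ) → sumAll n (λ b → f (a ⊕ b)) ≡ sumAll n f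
sumAll-⊕ zero [] f = refl
sumAll-⊕ (suc n) (false ∷ a) f = begin
  sumAll (suc n) (λ b → f ((false ∷ a) ⊕ b))
    ≡⟨ sumAll-suc n _ ⟩
  sumAll n (λ b → f (false ∷ a ⊕ b)) + sumAll n (λ b → f (true ∷ a ⊕ b))
    ≡⟨ cong₂ _+_ (sumAll-⊕ n a (f ∘ (false ∷_))) (sumAll-⊕ n a (f ∘ (true ∷_))) ⟩
  sumAll n (f ∘ (false ∷_)) + sumAll n (f ∘ (true ∷_))
    ≡⟨ sumAll-suc n f ⟨
  sumAll (suc n) f ∎
  where open ≡-Reasoning
sumAll-⊕ (suc n) (true ∷ a) f = begin
  sumAll (suc n) (λ b → f ((true ∷ a) ⊕ b))
    ≡⟨ sumAll-suc n _ ⟩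
  sumAll n (λ b → f (true ∷ a ⊕ b)) + sumAll n (λ b → f (false ∷ a ⊕ b))
    ≡⟨ cong₂ _+_ (sumAll-⊕ n a (f ∘ (true ∷_))) (sumAll-⊕ n a (f ∘ (false ∷_))) ⟩
  sumAll n (f ∘ (true ∷_)) + sumAll n (f ∘ (false ∷_))
    ≡⟨ +-comm (sumAll n (f ∘ (true ∷_))) _ ⟩
  sumAll n (f ∘ (false ∷_)) + sumAll n (f ∘ (true ∷_))
    ≡⟨ sumAll-suc n f ⟨
  sumAll (suc n) f ∎
  where open ≡-Reasoning

δ : ∀ {n} → Vec2 n → ℕ → Vec2 n → ℕ
δ p x b = if does (b ≟ p) then x else 0

δ-other : ∀ {n} {p b : Vec2 n} x → b ≢ p → δ p x b ≡ 0
δ-other {p = p} {b} x b≢p rewrite dec-false (b ≟ p) b≢p = refl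

sumAll-δ : ∀ n (p : Vec2 n) x → sumAll n (δ p x) ≡ x
sumAll-δ zero [] x = +-identityʳ x
sumAll-δ (suc n) (false ∷ p) x = begin
  sumAll (suc n) (δ (false ∷ p) x)         ≡⟨ sumAll-suc n _ ⟩
  sumAll n (δ p x) + sumAll n (λ _ → 0)    ≡⟨ cong₂ _+_ (sumAll-δ n p x) (sumAll-const n 0) ⟩
  x + 2 ^ n * 0                            ≡⟨ cong (x +_) (*-zeroʳ (2 ^ n)) ⟩
  x + 0                                    ≡⟨ +-identityʳ x ⟩
  x                                        ∎
  where open ≡-Reasoning
sumAll-δ (suc n) (true ∷ p) x = begin
  sumAll (suc n) (δ (true ∷ p) x)          ≡⟨ sumAll-suc n _ ⟩
  sumAll n (λ _ → 0) + sumAll n (δ p x)    ≡⟨ cong₂ _+_ (sumAll-const n 0) (sumAll-δ n p x) ⟩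
  2 ^ n * 0 + x                            ≡⟨ cong (_+ x) (*-zeroʳ (2 ^ n)) ⟩
  x                                        ∎
  where open ≡-Reasoning

sumAll-≤-except₂ : ∀ n {w} (h : Vec2 n → ℕ) {p q} → p ≢ q →
                   (∀ b → b ≢ p → b ≢ q → h b ≤ w) →
                   sumAll n h + w + w ≤ 2 ^ n * w + h p + h q
sumAll-≤-except₂ n {w} h {p} {q} p≢q h≤w = begin
  sumAll n h + w + w
    ≡⟨ cong₂ (λ x y → sumAll n h + x + y) (sumAll-δ n p w) (sumAll-δ n q w) ⟨
  sumAll n h + sumAll n (δ p w) + sumAll n (δ q w)
    ≡⟨ sum₃ h (δ p w) (δ q w) ⟨
  sumAll n (λ b → h b + δ p w b + δ q w b)
    ≤⟨ sumAll-mono n pointwise ⟩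
  sumAll n (λ b → w + δ p (h p) b + δ q (h q) b)
    ≡⟨ sum₃ (λ _ → w) (δ p (h p)) (δ q (h q)) ⟩
  sumAll n (λ _ → w) + sumAll n (δ p (h p)) + sumAll n (δ q (h q))
    ≡⟨ cong₂ _+_ (cong₂ _+_ (sumAll-const n w) (sumAll-δ n p (h p)))
                 (sumAll-δ n q (h q)) ⟩
  2 ^ n * w + h p + h q ∎
  where
  open ≤-Reasoning
  sum₃ : ∀ (f g k : Vec2 n → ℕ) →
         sumAll n (λ b → f b + g b + k b) ≡ sumAll n f + sumAll n g + sumAll n k
  sum₃ f g k = trans (sumAll-+ n (λ b → f b + g b) k) (cong (_+ sumAll n k) (sumAll-+ n f g))
  pointwise : ∀ b → h b + δ p w b + δ q w b ≤ w + δ p (h p) b + δ q (h q) b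
  pointwise b with b ≟ p | b ≟ q
  ... | yes refl | yes refl = ⊥-elim (p≢q refl)
  ... | yes refl | no _     = ≤-reflexive (cong (_+ 0) (+-comm (h b) w))
  ... | no _     | yes refl = ≤-reflexive (swap (h b) w)
    where
    swap : ∀ x y → x + 0 + y ≡ y + 0 + x
    swap = solve-∀
  ... | no b≢p   | no b≢q   = +-monoˡ-≤ 0 (+-monoˡ-≤ 0 (h≤w b b≢p b≢q))

-- Zeroes the junk value at the zero vector, so that sums over all of F_2^(N+1) count points only.
onPoints : ∀ {N} → Multiset N → Vec2 (suc N) → ℕ
onPoints M b = if nonzeroᵇ b then M b else 0

onPoints-zeroVec : ∀ {N} (M : Multiset N) → onPoints M (zeroVec (suc N)) ≡ 0
onPoints-zeroVec {N} M rewrite nonzeroᵇ-zeroVec N = refl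

onPoints-point : ∀ {N} (M : Multiset N) {b} → b ≢ zeroVec (suc N) → onPoints M b ≡ M b
onPoints-point M {b} b≢0 with nonzeroᵇ b in eq
... | true  = refl
... | false = ⊥-elim (b≢0 (nonzeroᵇ≡false⇒≡zeroVec b eq))

total-onPoints : ∀ {N} (M : Multiset N) → total M ≡ sumAll (suc N) (onPoints M)
total-onPoints {N} M = sum-map-filterᵇ nonzeroᵇ M (allVecs (suc N))

total-+ : ∀ {N} (M M′ : Multiset N) → total (λ b → M b + M′ b) ≡ total M + total M′
total-+ {N} M M′ = sum-map-+ M M′ (filterᵇ nonzeroᵇ (allVecs (suc N)))

total-mono : ∀ {N} {M M′ : Multiset N} →
             (∀ b → b ≢ zeroVec (suc N) → M b ≤ M′ b) → total M ≤ total M′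
total-mono {N} {M} {M′} M≤M′ = begin
  total M                         ≡⟨ total-onPoints M ⟩
  sumAll (suc N) (onPoints M)     ≤⟨ sumAll-mono (suc N) pointwise ⟩
  sumAll (suc N) (onPoints M′)    ≡⟨ total-onPoints M′ ⟨
  total M′                        ∎
  where
  open ≤-Reasoning
  pointwise : ∀ b → onPoints M b ≤ onPoints M′ b
  pointwise b with b ≟ zeroVec (suc N)
  ... | yes refl = ≤-reflexive (trans (onPoints-zeroVec M) (sym (onPoints-zeroVec M′)))
  ... | no b≢0   = subst₂ _≤_ (sym (onPoints-point M b≢0)) (sym (onPoints-point M′ b≢0))
                             (M≤M′ b b≢0)

total+zero≡sumAll : ∀ {N} (M : Multiset N) → total M + M (zeroVec (suc N)) ≡ sumAll (suc N) M
total+zero≡sumAll {N} M = begin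
  total M + M 𝟘
    ≡⟨ cong₂ _+_ (total-onPoints M) (sym (sumAll-δ (suc N) 𝟘 (M 𝟘))) ⟩
  sumAll (suc N) (onPoints M) + sumAll (suc N) (δ 𝟘 (M 𝟘))
    ≡⟨ sumAll-+ (suc N) (onPoints M) (δ 𝟘 (M 𝟘)) ⟨
  sumAll (suc N) (λ b → onPoints M b + δ 𝟘 (M 𝟘) b)
    ≡⟨ sumAll-cong (suc N) pointwise ⟩
  sumAll (suc N) M  ∎
  where
  open ≡-Reasoning
  𝟘 = zeroVec (suc N)
  pointwise : ∀ b → onPoints M b + δ 𝟘 (M 𝟘) b ≡ M b
  pointwise b with b ≟ 𝟘
  ... | yes refl = cong (_+ M 𝟘) (onPoints-zeroVec M)
  ... | no b≢0   = trans (+-identityʳ _) (onPoints-point M b≢0)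

total-const : ∀ N c → total {N} (λ _ → c) ≡ c * v (suc N)
total-const N c = begin
  total {N} (λ _ → c)           ≡⟨ m+n∸n≡m _ c ⟨
  total {N} (λ _ → c) + c ∸ c   ≡⟨ cong (_∸ c) (total+zero≡sumAll {N} (λ _ → c)) ⟩
  sumAll (suc N) (λ _ → c) ∸ c  ≡⟨ cong (_∸ c) (sumAll-const (suc N) c) ⟩
  2 ^ suc N * c ∸ c             ≡⟨ cong₂ _∸_ (*-comm c (2 ^ suc N)) (*-identityʳ c) ⟨
  c * 2 ^ suc N ∸ c * 1         ≡⟨ *-distribˡ-∸ c (2 ^ suc N) 1 ⟨
  c * v (suc N)                 ∎
  where open ≡-Reasoning

total-δ : ∀ {N} {p : Vec2 (suc N)} x → p ≢ zeroVec (suc N) → total (δ p x) ≡ x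
total-δ {N} {p} x p≢0 = begin
  total (δ p x)                            ≡⟨ +-identityʳ _ ⟨
  total (δ p x) + 0                        ≡⟨ cong (total (δ p x) +_) (δ-other x (p≢0 ∘ sym)) ⟨
  total (δ p x) + δ p x (zeroVec (suc N))  ≡⟨ total+zero≡sumAll (δ p x) ⟩
  sumAll (suc N) (δ p x)                   ≡⟨ sumAll-δ (suc N) p x ⟩
  x                                        ∎
  where open ≡-Reasoning

headℕ : ∀ {n} → Vec2 (suc n) → ℕ
headℕ (x ∷ _) = if x then 1 else 0

total-headℕ : ∀ N → total {N} headℕ ≡ 2 ^ N
total-headℕ N = begin
  total {N} headℕ                              ≡⟨ +-identityʳ _ ⟨
  total {N} headℕ + 0                          ≡⟨ total+zero≡sumAll {N} headℕ ⟩
  sumAll (suc N) headℕ                         ≡⟨ sumAll-suc N headℕ ⟩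
  sumAll N (λ _ → 0) + sumAll N (λ _ → 1)      ≡⟨ cong₂ _+_ (sumAll-const N 0) (sumAll-const N 1) ⟩
  2 ^ N * 0 + 2 ^ N * 1                        ≡⟨ cong₂ _+_ (*-zeroʳ (2 ^ N)) (*-identityʳ (2 ^ N)) ⟩
  2 ^ N                                        ∎
  where open ≡-Reasoning

suc-v : ∀ n → suc (v n) ≡ 2 ^ n
suc-v n = m+[n∸m]≡n (m^n>0 2 n)

v-suc : ∀ n → v (suc n) ≡ suc (2 * v n)
v-suc n = begin
  2 * 2 ^ n ∸ 1          ≡⟨ cong (λ x → 2 * x ∸ 1) (suc-v n) ⟨
  2 * suc (v n) ∸ 1      ≡⟨ +-suc (v n) (v n + 0) ⟩
  suc (2 * v n)          ∎
  where open ≡-Reasoning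

1≤v-suc : ∀ n → 1 ≤ v (suc n)
1≤v-suc n = subst (1 ≤_) (sym (v-suc n)) (s≤s z≤n)

-- v N counts the lines through a.  Summing M a + M b + M (a ⊕ b) over all vectors b counts
-- each of them twice (via b and a ⊕ b); b = 0 and b = a are the only terms that are not lines.
lines-through-point : ∀ {N w} (M : Multiset N) → LineBounded w M →
                      ∀ a → a ≢ zeroVec (suc N) → total M + v N * M a ≤ v N * w + M a
lines-through-point {N} {w} M bounded a a≢0 = halve (sym (suc-v N)) key
  where
  𝟘 = zeroVec (suc N)
  h : Vec2 (suc N) → ℕ
  h b = M a + onPoints M b + onPoints M (a ⊕ b)
  h-line : ∀ b → b ≢ 𝟘 → b ≢ a → h b ≤ w
  h-line b b≢0 b≢a = subst (_≤ w) (sym h≡lineMult) (bounded a b a≢0 b≢0 (b≢a ∘ sym))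
    where
    a⊕b≢0 : a ⊕ b ≢ 𝟘
    a⊕b≢0 = b≢a ∘ sym ∘ ⊕≡zero⇒≡ a b
    h≡lineMult : h b ≡ lineMult M a b
    h≡lineMult = cong₂ (λ x y → M a + x + y) (onPoints-point M b≢0) (onPoints-point M a⊕b≢0)
  sum-h : sumAll (suc N) h ≡ 2 ^ suc N * M a + total M + total M
  sum-h = begin
    sumAll (suc N) h ≡⟨ sumAll-+ (suc N) (λ b → M a + onPoints M b) _ ⟩
    sumAll (suc N) (λ b → M a + onPoints M b) + sumAll (suc N) (λ b → onPoints M (a ⊕ b))
      ≡⟨ cong₂ _+_ (sumAll-+ (suc N) (λ _ → M a) (onPoints M))
                   (sumAll-⊕ (suc N) a (onPoints M)) ⟩
    sumAll (suc N) (λ _ → M a) + sumAll (suc N) (onPoints M) + sumAll (suc N) (onPoints M)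
      ≡⟨ cong₂ (λ x y → x + y + y) (sumAll-const (suc N) (M a)) (sym (total-onPoints M)) ⟩
    2 ^ suc N * M a + total M + total M ∎
    where open ≡-Reasoning
  h-𝟘 : h 𝟘 ≡ M a + 0 + M a
  h-𝟘 = cong₂ (λ x y → M a + x + y) (onPoints-zeroVec M)
              (trans (cong (onPoints M) (⊕-identityʳ a)) (onPoints-point M a≢0))
  h-a : h a ≡ M a + M a + 0
  h-a = cong₂ (λ x y → M a + x + y) (onPoints-point M a≢0)
              (trans (cong (onPoints M) (⊕-self a)) (onPoints-zeroVec M))
  key : 2 * 2 ^ N * M a + total M + total M + w + w ≤
        2 * 2 ^ N * w + (M a + 0 + M a) + (M a + M a + 0)
  key = subst₂ _≤_ (cong (λ x → x + w + w) sum-h)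
                   (cong₂ (λ x y → 2 ^ suc N * w + x + y) h-𝟘 h-a)
               (sumAll-≤-except₂ (suc N) h (a≢0 ∘ sym) h-line)
  halve : ∀ {P r T m w} → P ≡ suc r →
          2 * P * m + T + T + w + w ≤ 2 * P * w + (m + 0 + m) + (m + m + 0) →
          T + r * m ≤ r * w + m
  halve {r = r} {T} {m} {w} refl H =
    +-cancelʳ-≤ (m + w) _ _ (*-cancelˡ-≤ 2 (subst₂ _≤_ (lhs r T m w) (rhs r m w) H))
    where
    lhs : ∀ r T m w → 2 * suc r * m + T + T + w + w ≡ 2 * (T + r * m + (m + w))
    lhs = solve-∀
    rhs : ∀ r m w → 2 * suc r * w + (m + 0 + m) + (m + m + 0) ≡ 2 * (r * w + m + (m + w))
    rhs = solve-∀

lineBound-antitone : ∀ {T r w m n} → 1 ≤ r → n ≤ m →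
                     T + r * m ≤ r * w + m → T + r * n ≤ r * w + n
lineBound-antitone {T} {r} {w} {m} {n} 1≤r n≤m H = +-cancelʳ-≤ d _ _ (begin
  T + r * n + d          ≤⟨ +-monoʳ-≤ (T + r * n) (m≤n*m d r {{>-nonZero 1≤r}}) ⟩
  T + r * n + r * d      ≡⟨ +-assoc T (r * n) (r * d) ⟩
  T + (r * n + r * d)    ≡⟨ cong (T +_) (*-distribˡ-+ r n d) ⟨
  T + r * (n + d)        ≡⟨ cong (λ x → T + r * x) m≡n+d ⟨
  T + r * m              ≤⟨ H ⟩
  r * w + m              ≡⟨ cong (r * w +_) m≡n+d ⟩
  r * w + (n + d)        ≡⟨ +-assoc (r * w) n d ⟨
  r * w + n + d          ∎)
  where
  open ≤-Reasoning
  d = m ∸ n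
  m≡n+d : m ≡ n + d
  m≡n+d = sym (m+[n∸m]≡n n≤m)

total-≤ : ∀ {N w} (M : Multiset (suc N)) → LineBounded w M → ∀ c {G} →
          c * v (suc (suc N)) ≤ G → v (suc N) * w + suc c ≡ v (suc N) * suc c + G →
          total M ≤ G
total-≤ {N} {w} M bounded c {G} light-bound heavy-bound
  with any? (λ b → ¬? (b ≟ zeroVec _) ×-dec (c <? M b))
... | yes (a , a≢0 , c<Ma) = +-cancelˡ-≤ (r * suc c) _ _ (begin
  r * suc c + total M    ≡⟨ +-comm (r * suc c) (total M) ⟩
  total M + r * suc c    ≤⟨ lineBound-antitone (1≤v-suc N) c<Ma
                               (lines-through-point M bounded a a≢0) ⟩
  r * w + suc c          ≡⟨ heavy-bound ⟩
  r * suc c + G          ∎)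
  where
  open ≤-Reasoning
  r = v (suc N)
... | no ∄heavy = begin
  total M                   ≤⟨ total-mono light ⟩
  total {suc N} (λ _ → c)   ≡⟨ total-const (suc N) c ⟩
  c * v (suc (suc N))       ≤⟨ light-bound ⟩
  G                         ∎
  where
  open ≤-Reasoning
  light : ∀ b → b ≢ zeroVec _ → M b ≤ c
  light b b≢0 = ≮⇒≥ (λ c<Mb → ∄heavy (b , b≢0 , c<Mb))

lineMult-offset : ∀ s x y z {k} → x + y + z ≤ k → (s + x) + (s + y) + (s + z) ≤ 3 * s + k
lineMult-offset s x y z {k} x+y+z≤k =
  subst (_≤ 3 * s + k) (sym (regroup s x y z)) (+-monoʳ-≤ (3 * s) x+y+z≤k)
  where
  regroup : ∀ s x y z → (s + x) + (s + y) + (s + z) ≡ 3 * s + (x + y + z)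
  regroup = solve-∀

headℕ-line : ∀ {n} (a b : Vec2 (suc n)) → headℕ a + headℕ b + headℕ (a ⊕ b) ≤ 2
headℕ-line (false ∷ _) (false ∷ _) = z≤n
headℕ-line (false ∷ _) (true ∷ _)  = ≤-refl
headℕ-line (true ∷ _)  (false ∷ _) = ≤-refl
headℕ-line (true ∷ _)  (true ∷ _)  = ≤-refl

δ-distinct₃ : ∀ {n} (p : Vec2 n) {x y z} → x ≢ y → x ≢ z → y ≢ z →
              δ p 1 x + δ p 1 y + δ p 1 z ≤ 1
δ-distinct₃ p {x} {y} {z} x≢y x≢z y≢z with x ≟ p | y ≟ p | z ≟ p
... | yes refl | yes refl | _        = ⊥-elim (x≢y refl)
... | yes refl | _        | yes refl = ⊥-elim (x≢z refl)
... | _        | yes refl | yes refl = ⊥-elim (y≢z refl)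
... | yes _    | no _     | no _     = ≤-refl
... | no _     | yes _    | no _     = ≤-refl
... | no _     | no _     | yes _    = ≤-refl
... | no _     | no _     | no _     = z≤n

isM2Line-3t+2 : ∀ N t → IsM2Line (suc N) (3 * t + 2) (t * v (suc (suc N)) + 2 ^ suc N)
isM2Line-3t+2 N t = (M , bounded , total-M) , λ M′ bounded′ → total-≤ M′ bounded′ t light heavy
  where
  r = v (suc N)
  M : Multiset (suc N)
  M b = t + headℕ b
  bounded : LineBounded (3 * t + 2) M
  bounded a b _ _ _ = lineMult-offset t _ _ _ (headℕ-line a b)
  total-M : total M ≡ t * v (suc (suc N)) + 2 ^ suc N
  total-M = trans (total-+ {suc N} (λ _ → t) headℕ)
                  (cong₂ _+_ (total-const (suc N) t) (total-headℕ (suc N)))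
  light : t * v (suc (suc N)) ≤ t * v (suc (suc N)) + 2 ^ suc N
  light = m≤m+n _ _
  heavy : r * (3 * t + 2) + suc t ≡ r * suc t + (t * v (suc (suc N)) + 2 ^ suc N)
  heavy = trans (regroup r t)
                (cong₂ (λ V P → r * suc t + (t * V + P)) (sym (v-suc (suc N))) (suc-v (suc N)))
    where
    regroup : ∀ r t → r * (3 * t + 2) + suc t ≡ r * suc t + (t * suc (2 * r) + suc r)
    regroup = solve-∀

isM2Line-3t+3 : ∀ N t → IsM2Line (suc N) (3 * t + 3) ((t + 1) * v (suc (suc N)))
isM2Line-3t+3 N t = (M , bounded , total-const (suc N) (t + 1)) ,
                    λ M′ bounded′ → total-≤ M′ bounded′ t light heavy
  where
  r = v (suc N)
  M : Multiset (suc N)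
  M _ = t + 1
  bounded : LineBounded (3 * t + 3) M
  bounded _ _ _ _ _ = lineMult-offset t 1 1 1 ≤-refl
  light : t * v (suc (suc N)) ≤ (t + 1) * v (suc (suc N))
  light = *-monoˡ-≤ (v (suc (suc N))) (m≤m+n t 1)
  heavy : r * (3 * t + 3) + suc t ≡ r * suc t + (t + 1) * v (suc (suc N))
  heavy = trans (regroup r t) (cong (λ V → r * suc t + (t + 1) * V) (sym (v-suc (suc N))))
    where
    regroup : ∀ r t → r * (3 * t + 3) + suc t ≡ r * suc t + (t + 1) * suc (2 * r)
    regroup = solve-∀

isM2Line-3t+4 : ∀ N t → IsM2Line (suc N) (3 * t + 4) ((t + 1) * v (suc (suc N)) + 1)
isM2Line-3t+4 N t = (M , bounded , total-M) , λ M′ bounded′ → total-≤ M′ bounded′ (t + 1) light heavy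
  where
  r = v (suc N)
  e : Vec2 (suc (suc N))
  e = true ∷ zeroVec (suc N)
  M : Multiset (suc N)
  M b = t + 1 + δ e 1 b
  bounded : LineBounded (3 * t + 4) M
  bounded a b a≢0 b≢0 a≢b = ≤-trans (lineMult-offset (t + 1) _ _ _ (δ-distinct₃ e a≢b a≢a⊕b b≢a⊕b))
                                    (≤-reflexive (regroup t))
    where
    a≢a⊕b : a ≢ a ⊕ b
    a≢a⊕b = b≢0 ∘ ⊕≡ˡ⇒≡zero a b ∘ sym
    b≢a⊕b : b ≢ a ⊕ b
    b≢a⊕b b≡a⊕b = a≢0 (⊕≡ˡ⇒≡zero b a (trans (⊕-comm b a) (sym b≡a⊕b)))
    regroup : ∀ t → 3 * (t + 1) + 1 ≡ 3 * t + 4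
    regroup = solve-∀
  total-M : total M ≡ (t + 1) * v (suc (suc N)) + 1
  total-M = trans (total-+ {suc N} (λ _ → t + 1) (δ e 1))
                  (cong₂ _+_ (total-const (suc N) (t + 1)) (total-δ {suc N} {e} 1 (λ ())))
  light : (t + 1) * v (suc (suc N)) ≤ (t + 1) * v (suc (suc N)) + 1
  light = m≤m+n _ 1
  heavy : r * (3 * t + 4) + suc (t + 1) ≡ r * suc (t + 1) + ((t + 1) * v (suc (suc N)) + 1)
  heavy = trans (regroup r t)
                (cong (λ V → r * suc (t + 1) + ((t + 1) * V + 1)) (sym (v-suc (suc N))))
    where
    regroup : ∀ r t →
              r * (3 * t + 4) + suc (t + 1) ≡ r * suc (t + 1) + ((t + 1) * suc (2 * r) + 1)
    regroup = solve-∀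

mainTheorem4 : (k t : ℕ) → 3 ≤ k →
    IsM2Line (k ∸ 1) (3 * t + 2) (t * v k + 2 ^ (k ∸ 1)) ×
    IsM2Line (k ∸ 1) (3 * t + 3) ((t + 1) * v k) ×
    IsM2Line (k ∸ 1) (3 * t + 4) ((t + 1) * v k + 1)
mainTheorem4 (suc (suc k)) t (s≤s (s≤s _)) =
  isM2Line-3t+2 k t , isM2Line-3t+3 k t , isM2Line-3t+4 k t
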